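{- Consider the presheaf CwF over $\mathrm{BPCube}$, and for a context $\Gamma$ let $\mathrm{Ty}^{\mathrm{Disc}}(\Gamma)$ be the set of discrete types over $\Gamma$. Then keeping the same contexts, substitutions, terms and context extension but taking $\mathrm{Ty}^{\mathrm{Disc}}$ as the types yields a category with families $\widehat{\mathrm{BPCube}}_{\mathrm{Disc}}$ (i.e. discreteness is stable under substitution), and this CwF supports dependent products, dependent sums and identity types (the standard presheaf $\Pi$-, $\Sigma$- and identity types of discrete types are discrete).
   Context: Fix an infinite set of names. $\mathrm{BPCube}$ has as objects pairs $W=(W_{\mathbb B},W_{\mathbb P})$ of disjoint finite sets of names (bridge and path dimensions); $(W,i:\mathbb P)$ denotes $(W_{\mathbb B},W_{\mathbb P}\uplus\{i\})$ for a fresh name $i$. A morphism $\varphi:V\to W$ assigns to each $i\in W_{\mathbb B}$ an element $i\langle\varphi\rangle\in\{0,1\}\cup V_{\mathbb B}$ and to each $i\in W_{\mathbb P}$ an element $i\langle\varphi\rangle\in\{0,1\}\cup V_{\mathbb B}\cup V_{\mathbb P}$; composition is substitution. $\mathrm{wk}_i:(W,i:\mathbb P)\to W$ sends every name of $W$ to itself. Presheaf CwF: contexts are presheaves $\Gamma$ on $\mathrm{BPCube}$ (restriction $\gamma\cdot\varphi$); a type $\Gamma\vdash T$ gives sets $T[\gamma]$ with functorial restrictions $t\langle\varphi\rangle\in T[\gamma\cdot\varphi]$, substitution $T[\sigma][\delta]=T[\sigma\delta]$; terms are restriction-compatible families; $(\Gamma.T)(W)=\{(\gamma,t)\}$. Standard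 $\Sigma$: pairs $(a,b)$, $a\in A[\gamma]$, $b\in B[(\gamma,a)]$. Standard $\Pi$: $(\Pi AB)[\gamma]$, for $\gamma\in\Gamma(W)$, is the set of families $f$ assigning to each $\varphi:V\to W$ and $a\in A[\gamma\cdot\varphi]$ an element $f(\varphi,a)\in B[(\gamma\cdot\varphi,a)]$ with $f(\varphi,a)\langle\psi\rangle=f(\varphi\psi,a\langle\psi\rangle)$; restriction $(f\langle\chi\rangle)(\varphi,a)=f(\chi\varphi,a)$. Identity type: $(a=_Ab)[\gamma]=\{\star\}$ if $a[\gamma]=b[\gamma]$, else $\emptyset$. An element $t\in T[\gamma]$ with $\gamma\in\Gamma(W,i:\mathbb P)$ is degenerate in $i$ if $\gamma=\gamma'\cdot\mathrm{wk}_i$ and $t=t'\langle\mathrm{wk}_i\rangle$ for some $\gamma'\in\Gamma(W)$, $t'\in T[\gamma']$; $\gamma$ is degenerate in $i$ if $\gamma=\gamma'\cdot\mathrm{wk}_i$. A type $T$ is discrete if for all $W$, fresh path names $i$ and $\gamma\in\Gamma(W,i:\mathbb P)$ degenerate in $i$, every $t\in T[\gamma]$ is degenerate in $i$. -}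

module Defs where

open import Level using (0ℓ)
open import Data.Bool using (Bool; true; false; T)
open import Data.Unit using (tt)
open import Data.Empty using (⊥-elim)
open import Relation.Nullary using (¬_)
open import Data.Nat using (ℕ; zero; suc; _<_; _<ᵇ_)
open import Data.Nat.Properties using (<ᵇ⇒<; <⇒<ᵇ; ≮⇒≥; ≤∧≢⇒<; <-trans)
open import Data.Fin using (Fin; zero; suc)
open import Data.List using (List; []; _∷_; length)
open import Data.List.Relation.Unary.All as All using (All; []; _∷_)
open import Data.List.Relation.Unary.AllPairs using (AllPairs; []; _∷_)
open import Data.List.Relation.Unary.Any using (here; there)
open import Data.List.Membership.Propositional using (_∈_; _∉_)
open import Data.Vec using (Vec; lookup; map; tabulate)
open import Data.Vec.Properties using (lookup-map; map-∘; map-cong)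
open import Data.Product using (Σ; Σ-syntax; _×_; _,_; proj₁; proj₂)
open import Data.Sum using (_⊎_; inj₁; inj₂)
open import Relation.Binary.PropositionalEquality
  using (_≡_; refl; sym; trans; cong; cong₂; subst)
open import Relation.Binary.HeterogeneousEquality as H using (_≅_)

-- Names are natural numbers.  A finite set of names is represented
-- canonically as a strictly increasing list.

mutual
  ins : ℕ → List ℕ → List ℕ
  ins i []       = i ∷ []
  ins i (x ∷ xs) = ins-aux (i <ᵇ x) i x xs

  ins-aux : Bool → ℕ → ℕ → List ℕ → List ℕ
  ins-aux true  i x xs = i ∷ x ∷ xs
  ins-aux false i x xs = x ∷ ins i xs

mutual
  emb : ∀ i xs → Fin (length xs) → Fin (length (ins i xs))
  emb i []       ()
  emb i (x ∷ xs) k = emb-aux (i <ᵇ x) i x xs k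

  emb-aux : ∀ b i x xs → Fin (suc (length xs)) → Fin (length (ins-aux b i x xs))
  emb-aux true  i x xs k       = suc k
  emb-aux false i x xs zero    = zero
  emb-aux false i x xs (suc k) = suc (emb i xs k)

all-ins : ∀ {P : ℕ → Set} i xs → P i → All P xs → All P (ins i xs)
all-ins i []       pi []         = pi ∷ []
all-ins i (x ∷ xs) pi (px ∷ pxs) with i <ᵇ x
... | true  = pi ∷ px ∷ pxs
... | false = px ∷ all-ins i xs pi pxs

∈-ins : ∀ {y} i xs → y ∈ ins i xs → y ≡ i ⊎ y ∈ xs
∈-ins i [] (here p) = inj₁ p
∈-ins i (x ∷ xs) m with i <ᵇ x
∈-ins i (x ∷ xs) (here p)  | true  = inj₁ p
∈-ins i (x ∷ xs) (there m) | true  = inj₂ m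
∈-ins i (x ∷ xs) (here p)  | false = inj₂ (here p)
∈-ins i (x ∷ xs) (there m) | false with ∈-ins i xs m
... | inj₁ p  = inj₁ p
... | inj₂ m' = inj₂ (there m')

sorted-ins : ∀ i xs → AllPairs _<_ xs → i ∉ xs → AllPairs _<_ (ins i xs)
sorted-ins i [] [] i∉ = [] ∷ []
sorted-ins i (x ∷ xs) (px ∷ ps) i∉ with i <ᵇ x in eq
... | true  = (i<x ∷ All.map (<-trans i<x) px) ∷ px ∷ ps
  where i<x = <ᵇ⇒< i x (subst T (sym eq) tt)
... | false = all-ins i xs x<i px ∷ sorted-ins i xs ps (λ m → i∉ (there m))
  where
  Tto≡ : ∀ {b} → T b → b ≡ true
  Tto≡ {true} _ = refl
  i≮x : ¬ (i < x)
  i≮x i<x with trans (sym eq) (Tto≡ (<⇒<ᵇ i<x))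
  ... | ()
  x<i : x < i
  x<i = ≤∧≢⇒< (≮⇒≥ i≮x) (λ x≡i → i∉ (here (sym x≡i)))

disjoint-ins : ∀ i {bs ps} → All (_∉ ps) bs → i ∉ bs → All (_∉ ins i ps) bs
disjoint-ins i {[]}     {ps} []       i∉ = []
disjoint-ins i {b ∷ bs} {ps} (d ∷ ds) i∉ =
  (λ m → helper (∈-ins i ps m)) ∷ disjoint-ins i ds (λ m → i∉ (there m))
  where
  helper : b ≡ i ⊎ b ∈ ps → Data.Empty.⊥
  helper (inj₁ b≡i) = i∉ (here (sym b≡i))
  helper (inj₂ m)   = d m

-- Objects of BPCube: pairs of disjoint finite sets of names
-- (bridge names, path names), each given as a strictly increasing list.
-- The well-formedness proofs are irrelevant, so an object is
-- determined by its two sets of names.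

record Obj : Set where
  constructor obj
  field
    bri pth     : List ℕ
    .bri-sorted : AllPairs _<_ bri
    .pth-sorted : AllPairs _<_ pth
    .disjoint   : All (_∉ pth) bri
open Obj public

nB nP : Obj → ℕ
nB W = length (bri W)
nP W = length (pth W)

Fresh : ℕ → Obj → Set
Fresh i W = i ∉ bri W × i ∉ pth W

ext : (W : Obj) (i : ℕ) → .(Fresh i W) → Obj
ext (obj b p bs ps d) i fr =
  obj b (ins i p) bs (sorted-ins i p ps (proj₂ fr)) (disjoint-ins i d (proj₁ fr))

-- A name of an object is referred to by its position in the
-- (sorted) list of names.  A value for a bridge name of W is an element
-- of {0,1} ∪ V_B, a value for a path name of W is an element of
-- {0,1} ∪ V_B ∪ V_P.

data BVal (m : ℕ) : Set where
  bcst : Bool → BVal m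
  bvar : Fin m → BVal m

data PVal (m n : ℕ) : Set where
  pcst : Bool → PVal m n
  pbv  : Fin m → PVal m n
  ppv  : Fin n → PVal m n

-- φ : V → W assigns i⟨φ⟩ to every name i of W
record Hom (V W : Obj) : Set where
  constructor hom
  field
    bmap : Vec (BVal (nB V)) (nB W)
    pmap : Vec (PVal (nB V) (nP V)) (nP W)
open Hom public

B→P : ∀ {m n} → BVal m → PVal m n
B→P (bcst b) = pcst b
B→P (bvar k) = pbv k

substB : ∀ {U V} → Hom U V → BVal (nB V) → BVal (nB U)
substB ψ (bcst b) = bcst b
substB ψ (bvar k) = lookup (bmap ψ) k

substP : ∀ {U V} → Hom U V → PVal (nB V) (nP V) → PVal (nB U) (nP U)
substP ψ (pcst b) = pcst b
substP ψ (pbv k)  = B→P (lookup (bmap ψ) k)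
substP ψ (ppv k)  = lookup (pmap ψ) k

idH : ∀ {W} → Hom W W
idH = hom (tabulate bvar) (tabulate ppv)

infixr 9 _∘H_
_∘H_ : ∀ {U V W} → Hom V W → Hom U V → Hom U W
φ ∘H ψ = hom (map (substB ψ) (bmap φ)) (map (substP ψ) (pmap φ))

substP-B→P : ∀ {U V} (χ : Hom U V) (u : BVal (nB V)) →
             substP χ (B→P u) ≡ B→P (substB χ u)
substP-B→P χ (bcst b) = refl
substP-B→P χ (bvar k) = refl

∘H-assoc : ∀ {T U V W} (φ : Hom V W) (ψ : Hom U V) (χ : Hom T U) →
           (φ ∘H ψ) ∘H χ ≡ φ ∘H (ψ ∘H χ)
∘H-assoc φ ψ χ = cong₂ hom
  (trans (sym (map-∘ (substB χ) (substB ψ) (bmap φ))) (map-cong eB (bmap φ)))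
  (trans (sym (map-∘ (substP χ) (substP ψ) (pmap φ))) (map-cong eP (pmap φ)))
  where
  eB : ∀ v → substB χ (substB ψ v) ≡ substB (ψ ∘H χ) v
  eB (bcst b) = refl
  eB (bvar k) = sym (lookup-map k (substB χ) (bmap ψ))
  eP : ∀ v → substP χ (substP ψ v) ≡ substP (ψ ∘H χ) v
  eP (pcst b) = refl
  eP (pbv k)  = trans (substP-B→P χ (lookup (bmap ψ) k))
                      (cong B→P (sym (lookup-map k (substB χ) (bmap ψ))))
  eP (ppv k)  = sym (lookup-map k (substP χ) (pmap ψ))

wk : (W : Obj) (i : ℕ) .(fr : Fresh i W) → Hom (ext W i fr) W
wk W i fr = hom (tabulate bvar) (tabulate (λ k → ppv (emb i (pth W) k)))

record Ctx : Set₁ where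
  infixl 5 _·_
  field
    ob   : Obj → Set
    _·_  : ∀ {W V} → ob W → Hom V W → ob V
    ·-id : ∀ {W} (γ : ob W) → γ · idH ≡ γ
    ·-∘  : ∀ {W V U} (γ : ob W) (φ : Hom V W) (ψ : Hom U V) →
           γ · (φ ∘H ψ) ≡ (γ · φ) · ψ
open Ctx public

record TyStr (Γ : Ctx) : Set₁ where
  field
    el  : ∀ {W} → ob Γ W → Set
    rst : ∀ {W V} {γ : ob Γ W} → el γ → (φ : Hom V W) → el (_·_ Γ γ φ)
open TyStr public

record Ty (Γ : Ctx) : Set₁ where
  field
    str    : TyStr Γ
    rst-id : ∀ {W} {γ : ob Γ W} (t : el str γ) → rst str t idH ≅ t
    rst-∘  : ∀ {W V U} {γ : ob Γ W} (t : el str γ) (φ : Hom V W) (ψ : Hom U V) →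
             rst str t (φ ∘H ψ) ≅ rst str (rst str t φ) ψ
open Ty public

,-≡ : ∀ {A : Set} {B : A → Set} {x y : A} {a : B x} {b : B y} →
      x ≡ y → a ≅ b → _≡_ {A = Σ A B} (x , a) (y , b)
,-≡ refl H.refl = refl

infixl 4 _▹_
_▹_ : (Γ : Ctx) → Ty Γ → Ctx
Γ ▹ A = record
  { ob   = λ W → Σ (ob Γ W) (el (str A))
  ; _·_  = λ { (γ , a) φ → (_·_ Γ γ φ , rst (str A) a φ) }
  ; ·-id = λ { (γ , a) → ,-≡ (·-id Γ γ) (rst-id A a) }
  ; ·-∘  = λ { (γ , a) φ ψ → ,-≡ (·-∘ Γ γ φ ψ) (rst-∘ A a φ ψ) }
  }

record Sub (Δ Γ : Ctx) : Set where
  field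
    fun : ∀ {W} → ob Δ W → ob Γ W
    nat : ∀ {W V} (δ : ob Δ W) (φ : Hom V W) →
          fun (_·_ Δ δ φ) ≡ _·_ Γ (fun δ) φ
open Sub public

record Tm (Γ : Ctx) (A : Ty Γ) : Set where
  field
    tm     : ∀ {W} (γ : ob Γ W) → el (str A) γ
    tm-nat : ∀ {W V} (γ : ob Γ W) (φ : Hom V W) →
             tm (_·_ Γ γ φ) ≡ rst (str A) (tm γ) φ
open Tm public

_[_] : ∀ {Δ Γ} → Ty Γ → Sub Δ Γ → TyStr Δ
T [ σ ] = record
  { el  = λ δ → el (str T) (fun σ δ)
  ; rst = λ {_} {_} {δ} t φ → subst (el (str T)) (sym (nat σ δ φ)) (rst (str T) t φ)
  }

ΣStr : ∀ {Γ} (A : Ty Γ) → Ty (Γ ▹ A) → TyStr Γ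
ΣStr A B = record
  { el  = λ γ → Σ (el (str A) γ) (λ a → el (str B) (γ , a))
  ; rst = λ { (a , b) φ → rst (str A) a φ , rst (str B) b φ }
  }

IdStr : ∀ {Γ} (A : Ty Γ) → Tm Γ A → Tm Γ A → TyStr Γ
IdStr {Γ} A a b = record
  { el  = λ γ → tm a γ ≡ tm b γ
  ; rst = λ {_} {_} {γ} e φ →
      trans (tm-nat a γ φ) (trans (cong (λ x → rst (str A) x φ) e) (sym (tm-nat b γ φ)))
  }

module _ {Γ : Ctx} (A : Ty Γ) (B : Ty (Γ ▹ A)) where
  private
    _∙_ = _·_ Γ
    elA = el (str A)
    elB = el (str B)
    rA  = rst (str A)
    rB  = rst (str B)
  infixl 5 _∙_

  castA : ∀ {W V U} (γ : ob Γ W) (φ : Hom V W) (ψ : Hom U V) →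
          elA ((γ ∙ φ) ∙ ψ) → elA (γ ∙ (φ ∘H ψ))
  castA γ φ ψ a = subst elA (sym (·-∘ Γ γ φ ψ)) a

  record ΠEl {W} (γ : ob Γ W) : Set where
    field
      app     : ∀ {V} (φ : Hom V W) (a : elA (γ ∙ φ)) → elB (γ ∙ φ , a)
      app-nat : ∀ {V U} (φ : Hom V W) (a : elA (γ ∙ φ)) (ψ : Hom U V) →
                rB (app φ a) ψ ≅ app (φ ∘H ψ) (castA γ φ ψ (rA a ψ))
  open ΠEl public

  private
    castA≅ : ∀ {W V U} (γ : ob Γ W) (φ : Hom V W) (ψ : Hom U V) a →
             castA γ φ ψ a ≅ a
    castA≅ γ φ ψ a = H.≡-subst-removable elA (sym (·-∘ Γ γ φ ψ)) a

    E : ∀ {W V U} (γ : ob Γ W) (χ : Hom V W) (φ : Hom U V) (a : elA ((γ ∙ χ) ∙ φ)) →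
        _≡_ {A = ob (Γ ▹ A) U} (γ ∙ (χ ∘H φ) , castA γ χ φ a) ((γ ∙ χ) ∙ φ , a)
    E γ χ φ a = ,-≡ (·-∘ Γ γ χ φ) (castA≅ γ χ φ a)

    rB-subst : ∀ {V U} {p q : ob (Γ ▹ A) V} (e : p ≡ q) (x : elB p) (ψ : Hom U V) →
               rB (subst elB e x) ψ ≅ rB x ψ
    rB-subst refl x ψ = H.refl

    rA-cong : ∀ {V U} {p q : ob Γ V} → p ≡ q → {x : elA p} {y : elA q} → x ≅ y →
              (ψ : Hom U V) → rA x ψ ≅ rA y ψ
    rA-cong refl H.refl ψ = H.refl

    app-cong : ∀ {W} {γ : ob Γ W} (f : ΠEl γ) {V} {φ φ' : Hom V W} → φ ≡ φ' →
               {a : elA (γ ∙ φ)} {a' : elA (γ ∙ φ')} → a ≅ a' →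
               app f φ a ≅ app f φ' a'
    app-cong f refl H.refl = H.refl

  Πrst : ∀ {W V} {γ : ob Γ W} → ΠEl γ → (χ : Hom V W) → ΠEl (γ ∙ χ)
  Πrst {γ = γ} f χ = record
    { app     = λ φ a → subst elB (E γ χ φ a) (app f (χ ∘H φ) (castA γ χ φ a))
    ; app-nat = λ φ a ψ →
        H.trans (rB-subst (E γ χ φ a) _ ψ)
        (H.trans (app-nat f (χ ∘H φ) (castA γ χ φ a) ψ)
        (H.trans (app-cong f (∘H-assoc χ φ ψ)
                   (H.trans (castA≅ γ (χ ∘H φ) ψ _)
                   (H.trans (rA-cong (·-∘ Γ γ χ φ) (castA≅ γ χ φ a) ψ)
                   (H.sym (H.trans (castA≅ γ χ (φ ∘H ψ) _) (castA≅ (γ ∙ χ) φ ψ _))))))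
        (H.sym (H.≡-subst-removable elB (E γ χ (φ ∘H ψ) _) _))))
    }

  ΠStr : TyStr Γ
  ΠStr = record { el = ΠEl ; rst = Πrst }

module _ {Γ : Ctx} where
  DegCtx : (W : Obj) (i : ℕ) (fr : Fresh i W) → ob Γ (ext W i fr) → Set
  DegCtx W i fr γ = Σ[ γ' ∈ ob Γ W ] γ ≡ _·_ Γ γ' (wk W i fr)

  DegEl : (T : TyStr Γ) (W : Obj) (i : ℕ) (fr : Fresh i W)
          (γ : ob Γ (ext W i fr)) → el T γ → Set
  DegEl T W i fr γ t =
    Σ[ γ' ∈ ob Γ W ] Σ[ t' ∈ el T γ' ] Σ[ e ∈ γ ≡ _·_ Γ γ' (wk W i fr) ]
      subst (el T) e t ≡ rst T t' (wk W i fr)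

  Discrete : TyStr Γ → Set
  Discrete T = ∀ (W : Obj) (i : ℕ) (fr : Fresh i W) (γ : ob Γ (ext W i fr)) →
               DegCtx W i fr γ → (t : el T γ) → DegEl T W i fr γ t

module Submission where

-- The whole argument rests on the structure of the objects (W , i:𝕡).
-- A map U → (W , i:𝕡) is the same thing as a map χ : U → W together with
-- a value y for i; we write it  pair χ y.  In particular the face
-- face y = pair id y  is a section of  wk_i, so restriction along wk_i is
-- injective on contexts and on types.  Injectivity on contexts shows that
-- discreteness may be checked over the chosen degenerate base γ' (the
-- notion DiscreteOver below); injectivity on types makes identity types
-- discrete outright.  Substitution and Σ then follow by transporting
-- degeneracy witnesses.
--
-- For Π, an element f over γ'·wk_i is shown to be the weakening of its
-- restriction f₀ to the face i = 0.  The heart of the proof is that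
-- f(pair χ y , a) does not depend on y: with j a fresh path name, the
-- generic map  pair (χ ∘ wk_j) j : (V , j:𝕡) → (W , i:𝕡)  yields a value
-- of f lying over a degenerate base, hence degenerate by discreteness of
-- B, and each f(pair χ y , a) is the restriction of that value along
-- face_j y, i.e. always the same element.  (So Π only needs B discrete,
-- and identity types need no hypothesis at all.)

open import Defs
open import Level using (0ℓ)
open import Data.Product using (_×_)
open import Axiom.Extensionality.Propositional using (Extensionality)

open import Axiom.Extensionality.Propositional using (implicit-extensionality)
open import Axiom.UniquenessOfIdentityProofs.WithK using (uip)
open import Data.Bool using (true; false)
open import Data.Nat using (ℕ; zero; suc; _<ᵇ_; _+_; _≤_; s≤s)
open import Data.Nat.Properties using (≤-trans; m≤m+n; m≤n+m; <-irrefl)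
open import Data.Nat.ListAction using (sum)
open import Data.Fin using (Fin; zero; suc)
open import Data.List using ([]; _∷_; length)
open import Data.List.Relation.Unary.Any using (here; there)
open import Data.List.Membership.Propositional using (_∈_)
open import Data.Vec using (Vec; lookup; tabulate)
open import Data.Vec.Properties using (lookup-map; lookup∘tabulate; tabulate∘lookup; tabulate-cong)
open import Data.Product using (Σ-syntax; _,_; proj₁; proj₂)
open import Relation.Binary.PropositionalEquality
  using (_≡_; refl; sym; trans; cong; cong₂; subst; module ≡-Reasoning)
open import Relation.Binary.PropositionalEquality.Properties using (subst-sym-subst)
open import Relation.Binary.HeterogeneousEquality as H using (_≅_)

mutual
  pos : ∀ i xs → Fin (length (ins i xs))
  pos i []       = zero
  pos i (x ∷ xs) = pos-aux (i <ᵇ x) i x xs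

  pos-aux : ∀ b i x xs → Fin (length (ins-aux b i x xs))
  pos-aux true  i x xs = zero
  pos-aux false i x xs = suc (pos i xs)

mutual
  ins-elim : ∀ i xs (P : Fin (length (ins i xs)) → Set) →
             P (pos i xs) → (∀ k → P (emb i xs k)) → ∀ p → P p
  ins-elim i []       P new old zero = new
  ins-elim i (x ∷ xs) P new old p    = ins-elim-aux (i <ᵇ x) i x xs P new old p

  ins-elim-aux : ∀ b i x xs (P : Fin (length (ins-aux b i x xs)) → Set) →
                 P (pos-aux b i x xs) → (∀ k → P (emb-aux b i x xs k)) → ∀ p → P p
  ins-elim-aux true  i x xs P new old zero    = new
  ins-elim-aux true  i x xs P new old (suc k) = old k
  ins-elim-aux false i x xs P new old zero    = old zero
  ins-elim-aux false i x xs P new old (suc p) =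
    ins-elim i xs (λ q → P (suc q)) new (λ k → old (suc k)) p

mutual
  ins-elim-pos : ∀ i xs P new old → ins-elim i xs P new old (pos i xs) ≡ new
  ins-elim-pos i []       P new old = refl
  ins-elim-pos i (x ∷ xs) P new old = ins-elim-pos-aux (i <ᵇ x) i x xs P new old

  ins-elim-pos-aux : ∀ b i x xs P new old →
                     ins-elim-aux b i x xs P new old (pos-aux b i x xs) ≡ new
  ins-elim-pos-aux true  i x xs P new old = refl
  ins-elim-pos-aux false i x xs P new old = ins-elim-pos i xs _ new _

mutual
  ins-elim-emb : ∀ i xs P new old k → ins-elim i xs P new old (emb i xs k) ≡ old k
  ins-elim-emb i []       P new old ()
  ins-elim-emb i (x ∷ xs) P new old k = ins-elim-emb-aux (i <ᵇ x) i x xs P new old k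

  ins-elim-emb-aux : ∀ b i x xs P new old k →
                     ins-elim-aux b i x xs P new old (emb-aux b i x xs k) ≡ old k
  ins-elim-emb-aux true  i x xs P new old k       = refl
  ins-elim-emb-aux false i x xs P new old zero    = refl
  ins-elim-emb-aux false i x xs P new old (suc k) = ins-elim-emb i xs _ new _ k

vec-ext : ∀ {A : Set} {n} (u v : Vec A n) → (∀ k → lookup u k ≡ lookup v k) → u ≡ v
vec-ext u v h = trans (sym (tabulate∘lookup u)) (trans (tabulate-cong h) (tabulate∘lookup v))

hom-ext : ∀ {V W} (φ ψ : Hom V W) →
          (∀ k → lookup (bmap φ) k ≡ lookup (bmap ψ) k) →
          (∀ k → lookup (pmap φ) k ≡ lookup (pmap ψ) k) → φ ≡ ψ
hom-ext φ ψ hb hp = cong₂ hom (vec-ext _ _ hb) (vec-ext _ _ hp)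

lookup-∘B : ∀ {U V W} (φ : Hom V W) (ψ : Hom U V) k →
            lookup (bmap (φ ∘H ψ)) k ≡ substB ψ (lookup (bmap φ) k)
lookup-∘B φ ψ k = lookup-map k (substB ψ) (bmap φ)

lookup-∘P : ∀ {U V W} (φ : Hom V W) (ψ : Hom U V) k →
            lookup (pmap (φ ∘H ψ)) k ≡ substP ψ (lookup (pmap φ) k)
lookup-∘P φ ψ k = lookup-map k (substP ψ) (pmap φ)

substB-id : ∀ {W} (v : BVal (nB W)) → substB (idH {W}) v ≡ v
substB-id (bcst b) = refl
substB-id (bvar k) = lookup∘tabulate bvar k

substP-id : ∀ {W} (v : PVal (nB W) (nP W)) → substP (idH {W}) v ≡ v
substP-id (pcst b) = refl
substP-id (pbv k)  = cong B→P (lookup∘tabulate bvar k)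
substP-id (ppv k)  = lookup∘tabulate ppv k

∘H-identityˡ : ∀ {V W} (χ : Hom V W) → idH ∘H χ ≡ χ
∘H-identityˡ χ = hom-ext _ _
  (λ k → trans (lookup-∘B idH χ k) (cong (substB χ) (lookup∘tabulate bvar k)))
  (λ k → trans (lookup-∘P idH χ k) (cong (substP χ) (lookup∘tabulate ppv k)))

∘H-identityʳ : ∀ {V W} (χ : Hom V W) → χ ∘H idH ≡ χ
∘H-identityʳ χ = hom-ext _ _
  (λ k → trans (lookup-∘B χ idH k) (substB-id _))
  (λ k → trans (lookup-∘P χ idH k) (substP-id _))

module Extension (W : Obj) (i : ℕ) .(fr : Fresh i W) where

  weaken : Hom (ext W i fr) W
  weaken = wk W i fr

  pair-values : ∀ {U} → Hom U W → PVal (nB U) (nP U) → Fin (nP (ext W i fr)) → PVal (nB U) (nP U)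
  pair-values {U} χ y = ins-elim i (pth W) (λ _ → PVal (nB U) (nP U)) y (lookup (pmap χ))

  pair : ∀ {U} → Hom U W → PVal (nB U) (nP U) → Hom U (ext W i fr)
  pair χ y = hom (bmap χ) (tabulate (pair-values χ y))

  face : PVal (nB W) (nP W) → Hom W (ext W i fr)
  face y = pair idH y

  pair-new : ∀ {U} (χ : Hom U W) y → lookup (pmap (pair χ y)) (pos i (pth W)) ≡ y
  pair-new χ y = trans (lookup∘tabulate (pair-values χ y) _) (ins-elim-pos i (pth W) _ y _)

  pair-old : ∀ {U} (χ : Hom U W) y k →
             lookup (pmap (pair χ y)) (emb i (pth W) k) ≡ lookup (pmap χ) k
  pair-old χ y k = trans (lookup∘tabulate (pair-values χ y) _) (ins-elim-emb i (pth W) _ y _ k)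

  lookup-weakenB : ∀ {U} (φ : Hom U (ext W i fr)) k →
                   lookup (bmap (weaken ∘H φ)) k ≡ lookup (bmap φ) k
  lookup-weakenB φ k = trans (lookup-∘B weaken φ k) (cong (substB φ) (lookup∘tabulate bvar k))

  lookup-weakenP : ∀ {U} (φ : Hom U (ext W i fr)) k →
                   lookup (pmap (weaken ∘H φ)) k ≡ lookup (pmap φ) (emb i (pth W) k)
  lookup-weakenP φ k =
    trans (lookup-∘P weaken φ k) (cong (substP φ) (lookup∘tabulate (λ k → ppv (emb i (pth W) k)) k))

  weaken-pair : ∀ {U} (χ : Hom U W) y → weaken ∘H pair χ y ≡ χ
  weaken-pair χ y = hom-ext _ _
    (λ k → lookup-weakenB (pair χ y) k)
    (λ k → trans (lookup-weakenP (pair χ y) k) (pair-old χ y k))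

  weaken-face : ∀ y → weaken ∘H face y ≡ idH
  weaken-face = weaken-pair idH

  pair-unique : ∀ {U} (φ : Hom U (ext W i fr)) {χ y} →
                weaken ∘H φ ≡ χ → lookup (pmap φ) (pos i (pth W)) ≡ y → φ ≡ pair χ y
  pair-unique φ {χ} {y} refl φi≡y = hom-ext _ _
    (λ k → sym (lookup-weakenB φ k))
    (ins-elim i (pth W) _
      (trans φi≡y (sym (pair-new χ y)))
      (λ k → sym (trans (pair-old χ y k) (lookup-weakenP φ k))))

  pair-η : ∀ {U} (φ : Hom U (ext W i fr)) →
           φ ≡ pair (weaken ∘H φ) (lookup (pmap φ) (pos i (pth W)))
  pair-η φ = pair-unique φ refl refl

  pair-∘ : ∀ {T U} (χ : Hom U W) y (τ : Hom T U) → pair χ y ∘H τ ≡ pair (χ ∘H τ) (substP τ y)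
  pair-∘ χ y τ = pair-unique (pair χ y ∘H τ)
    (trans (sym (∘H-assoc weaken (pair χ y) τ)) (cong (_∘H τ) (weaken-pair χ y)))
    (trans (lookup-∘P (pair χ y) τ _) (cong (substP τ) (pair-new χ y)))

  face-∘ : ∀ {U} y (χ : Hom U W) → face y ∘H χ ≡ pair χ (substP χ y)
  face-∘ y χ = trans (pair-∘ idH y χ) (cong (λ φ → pair φ (substP χ y)) (∘H-identityˡ χ))

module Generic (W : Obj) (i : ℕ) .(fr : Fresh i W) {V : Obj} (χ : Hom V W)
               (j : ℕ) .(frj : Fresh j V) where
  open Extension W i fr
  module Eⱼ = Extension V j frj

  generic : Hom (ext V j frj) (ext W i fr)
  generic = pair (χ ∘H Eⱼ.weaken) (ppv (pos j (pth V)))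

  generic-face : ∀ y → generic ∘H Eⱼ.face y ≡ pair χ y
  generic-face y = begin
    generic ∘H Eⱼ.face y
      ≡⟨ pair-∘ (χ ∘H Eⱼ.weaken) _ (Eⱼ.face y) ⟩
    pair ((χ ∘H Eⱼ.weaken) ∘H Eⱼ.face y) (lookup (pmap (Eⱼ.face y)) (pos j (pth V)))
      ≡⟨ cong₂ pair χ-weaken-face (Eⱼ.pair-new idH y) ⟩
    pair χ y ∎
    where
    open ≡-Reasoning
    χ-weaken-face : (χ ∘H Eⱼ.weaken) ∘H Eⱼ.face y ≡ χ
    χ-weaken-face = trans (∘H-assoc χ Eⱼ.weaken (Eⱼ.face y))
                          (trans (cong (χ ∘H_) (Eⱼ.weaken-face y)) (∘H-identityʳ χ))

-- Every object has a fresh name: one more than the sum of its names.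
∈⇒≤sum : ∀ {x} xs → x ∈ xs → x ≤ sum xs
∈⇒≤sum (y ∷ ys) (here refl) = m≤m+n y (sum ys)
∈⇒≤sum (y ∷ ys) (there m)   = ≤-trans (∈⇒≤sum ys m) (m≤n+m (sum ys) y)

fresh : Obj → ℕ
fresh V = suc (sum (bri V) + sum (pth V))

fresh-ok : ∀ V → Fresh (fresh V) V
fresh-ok V =
    (λ m → <-irrefl refl (s≤s (≤-trans (∈⇒≤sum _ m) (m≤m+n _ _))))
  , (λ m → <-irrefl refl (s≤s (≤-trans (∈⇒≤sum _ m) (m≤n+m _ _))))

module _ (Δ : Ctx) (W : Obj) (i : ℕ) .(fr : Fresh i W) where
  open Extension W i fr
  private
    _∙_ : ∀ {W V} → ob Δ W → Hom V W → ob Δ V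
    _∙_ = _·_ Δ
  infixl 5 _∙_

  restrict-pair : (γ : ob Δ W) {U : Obj} (χ : Hom U W) (y : PVal (nB U) (nP U)) →
                  (γ ∙ weaken) ∙ pair χ y ≡ γ ∙ χ
  restrict-pair γ χ y = trans (sym (·-∘ Δ γ weaken (pair χ y))) (cong (γ ∙_) (weaken-pair χ y))

  restrict-face : (γ : ob Δ W) (y : PVal (nB W) (nP W)) → (γ ∙ weaken) ∙ face y ≡ γ
  restrict-face γ y = trans (restrict-pair γ idH y) (·-id Δ γ)

  weaken-injective : {γ₁ γ₂ : ob Δ W} → γ₁ ∙ weaken ≡ γ₂ ∙ weaken → γ₁ ≡ γ₂
  weaken-injective {γ₁} {γ₂} e = begin
    γ₁                         ≡⟨ restrict-face γ₁ (pcst false) ⟨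
    (γ₁ ∙ weaken) ∙ face₀      ≡⟨ cong (_∙ face₀) e ⟩
    (γ₂ ∙ weaken) ∙ face₀      ≡⟨ restrict-face γ₂ (pcst false) ⟩
    γ₂                         ∎
    where
    open ≡-Reasoning
    face₀ : Hom W (ext W i fr)
    face₀ = face (pcst false)

rst-cong : ∀ {Δ} (T : TyStr Δ) {V U : Obj} {p q : ob Δ V} → p ≡ q →
           {x : el T p} {y : el T q} → x ≅ y → (ψ : Hom U V) → rst T x ψ ≅ rst T y ψ
rst-cong T refl H.refl ψ = H.refl

module _ {Δ : Ctx} (T : Ty Δ) (W : Obj) (i : ℕ) .(fr : Fresh i W) where
  open Extension W i fr
  private
    rT : ∀ {W V} {γ : ob Δ W} → el (str T) γ → (φ : Hom V W) → el (str T) (_·_ Δ γ φ)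
    rT = rst (str T)

  rst-weaken-face : ∀ {γ : ob Δ W} y (x : el (str T) γ) → rT (rT x weaken) (face y) ≅ x
  rst-weaken-face y x =
    H.trans (H.sym (rst-∘ T x weaken (face y)))
    (H.trans (rst-along (weaken-face y)) (rst-id T x))
    where
    rst-along : ∀ {φ φ' : Hom W W} → φ ≡ φ' → rT x φ ≅ rT x φ'
    rst-along refl = H.refl

  rst-weaken-injective : ∀ {γ : ob Δ W} {x x' : el (str T) γ} → rT x weaken ≡ rT x' weaken → x ≡ x'
  rst-weaken-injective {x = x} {x'} e = H.≅-to-≡
    (H.trans (H.sym (rst-weaken-face (pcst false) x))
    (H.trans (H.≡-to-≅ (cong (λ z → rT z (face (pcst false))) e))
             (rst-weaken-face (pcst false) x')))

DiscreteOver : {Γ : Ctx} → TyStr Γ → Set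
DiscreteOver {Γ} T = ∀ W i (fr : Fresh i W) (γ : ob Γ W) (t : el T (_·_ Γ γ (wk W i fr))) →
                     Σ[ t' ∈ el T γ ] t ≡ rst T t' (wk W i fr)

-- Since restriction along wk_i is injective on contexts, this is equivalent
-- to discreteness.
discrete⇒over : ∀ {Γ} (T : TyStr Γ) → Discrete T → DiscreteOver T
discrete⇒over {Γ} T D W i fr γ t with D W i fr _ (γ , refl) t
... | γ'' , t'' , e , p = degenerate-over (weaken-injective Γ W i fr e) t'' e p
  where
  degenerate-over : ∀ {γ''} → γ ≡ γ'' → (t'' : el T γ'') (e : _·_ Γ γ (wk W i fr) ≡ _·_ Γ γ'' (wk W i fr)) →
                    subst (el T) e t ≡ rst T t'' (wk W i fr) → Σ[ t' ∈ el T γ ] t ≡ rst T t' (wk W i fr)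
  degenerate-over refl t'' refl p = t'' , p

over⇒discrete : ∀ {Γ} (T : TyStr Γ) → DiscreteOver T → Discrete T
over⇒discrete T O W i fr ._ (γ , refl) t with O W i fr γ t
... | t' , p = γ , t' , refl , p

discreteOver-substitution : ∀ {Δ Γ} (σ : Sub Δ Γ) (T : Ty Γ) →
                            DiscreteOver (str T) → DiscreteOver (T [ σ ])
discreteOver-substitution {Δ} {Γ} σ T O W i fr δ t =
  proj₁ degenerate , trans (sym (subst-sym-subst e)) (cong (subst (el (str T)) (sym e)) (proj₂ degenerate))
  where
  e : fun σ (_·_ Δ δ (wk W i fr)) ≡ _·_ Γ (fun σ δ) (wk W i fr)
  e = nat σ δ (wk W i fr)
  degenerate : Σ[ t' ∈ el (str T) (fun σ δ) ] subst (el (str T)) e t ≡ rst (str T) t' (wk W i fr)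
  degenerate = O W i fr (fun σ δ) (subst (el (str T)) e t)

discreteOver-Σ : ∀ {Γ} (A : Ty Γ) (B : Ty (Γ ▹ A)) →
                 DiscreteOver (str A) → DiscreteOver (str B) → DiscreteOver (ΣStr A B)
discreteOver-Σ A B OA OB W i fr γ (a , b) with OA W i fr γ a
... | a' , refl with OB W i fr (γ , a') b
... | b' , refl = (a' , b') , refl

-- identity types are discrete whatever A is: an equation over γ'·wk_i
-- descends to γ' by injectivity of restriction, and proofs are unique
discreteOver-Id : ∀ {Γ} (A : Ty Γ) (a b : Tm Γ A) → DiscreteOver (IdStr A a b)
discreteOver-Id A a b W i fr γ e = e' , uip _ _
  where
  e' : tm a γ ≡ tm b γ
  e' = rst-weaken-injective A W i fr
         (trans (sym (tm-nat a γ (wk W i fr))) (trans e (tm-nat b γ (wk W i fr))))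

module PiDiscrete (fe : Extensionality 0ℓ 0ℓ) {Γ : Ctx} (A : Ty Γ) (B : Ty (Γ ▹ A)) where
  private
    _∙_ : ∀ {W V} → ob Γ W → Hom V W → ob Γ V
    _∙_ = _·_ Γ
    elA : ∀ {W} → ob Γ W → Set
    elA = el (str A)
    elB : ∀ {W} → ob (Γ ▹ A) W → Set
    elB = el (str B)
    rA : ∀ {W V} {γ : ob Γ W} → elA γ → (φ : Hom V W) → elA (γ ∙ φ)
    rA = rst (str A)
  infixl 5 _∙_

  app-cong : ∀ {W} {γ : ob Γ W} (f : ΠEl A B γ) {V} {φ φ' : Hom V W} → φ ≡ φ' →
             {a : elA (γ ∙ φ)} {a' : elA (γ ∙ φ')} → a ≅ a' → app f φ a ≅ app f φ' a'
  app-cong f refl H.refl = H.refl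

  app-subst : ∀ {W} {γ₁ γ₂ : ob Γ W} (e : γ₁ ≡ γ₂) (f : ΠEl A B γ₁) {V} (φ : Hom V W)
              {a : elA (γ₂ ∙ φ)} {a' : elA (γ₁ ∙ φ)} → a ≅ a' →
              app (subst (ΠEl A B) e f) φ a ≅ app f φ a'
  app-subst refl f φ H.refl = H.refl

  castA-removable : ∀ {W V U} (γ : ob Γ W) (φ : Hom V W) (ψ : Hom U V) (a : elA ((γ ∙ φ) ∙ ψ)) →
                    castA A B γ φ ψ a ≅ a
  castA-removable γ φ ψ a = H.≡-subst-removable elA (sym (·-∘ Γ γ φ ψ)) a

  app-Πrst : ∀ {W V U} {γ : ob Γ W} (f : ΠEl A B γ) (χ : Hom V W) (φ : Hom U V)
             (a : elA ((γ ∙ χ) ∙ φ)) → app (Πrst A B f χ) φ a ≅ app f (χ ∘H φ) (castA A B γ χ φ a)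
  app-Πrst {γ = γ} f χ φ a =
    H.≡-subst-removable elB (,-≡ (·-∘ Γ γ χ φ) (castA-removable γ χ φ a)) _

  -- elements of Π are determined by their values (naturality is a proposition)
  ΠEl-ext : ∀ {W} {γ : ob Γ W} (f g : ΠEl A B γ) →
            (∀ {V} (φ : Hom V W) a → app f φ a ≡ app g φ a) → f ≡ g
  ΠEl-ext {W} {γ} f g h =
    mk-≡ (implicit-extensionality fe (fe λ φ → fe λ a → h φ a)) (app-nat f) (app-nat g)
    where
    Values : Set
    Values = ∀ {V} (φ : Hom V W) (a : elA (γ ∙ φ)) → elB (γ ∙ φ , a)
    Natural : Values → Set
    Natural v = ∀ {V U} (φ : Hom V W) (a : elA (γ ∙ φ)) (ψ : Hom U V) →
                rst (str B) (v φ a) ψ ≅ v (φ ∘H ψ) (castA A B γ φ ψ (rA a ψ))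
    mk-≡ : ∀ {v v' : Values} → (λ {V} → v {V}) ≡ v' → (n : Natural v) (n' : Natural v') →
           _≡_ {A = ΠEl A B γ} (record { app = v ; app-nat = n }) (record { app = v' ; app-nat = n' })
    mk-≡ {v} refl n n' = cong {A = Natural v} (λ n → record { app = v ; app-nat = n })
      (implicit-extensionality fe (implicit-extensionality fe
        (fe λ φ → fe λ a → fe λ ψ → H.≅-irrelevant (n φ a ψ) (n' φ a ψ))))

  module Weakened (DB : DiscreteOver (str B)) (W : Obj) (i : ℕ) .(fr : Fresh i W)
                  (γ : ob Γ W) (f : ΠEl A B (γ ∙ wk W i fr)) where
    open Extension W i fr

    -- Over a fixed χ and a, the values  f(pair χ y , a)  are all equal to
    -- one element b₀, obtained from the value of f at the generic map.
    module Constant {V : Obj} (χ : Hom V W) (a : elA (γ ∙ χ)) where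
      private
        j : ℕ
        j = fresh V
        frj : Fresh j V
        frj = fresh-ok V
        open Generic W i fr χ j frj

        base : (γ ∙ weaken) ∙ generic ≡ (γ ∙ χ) ∙ Eⱼ.weaken
        base = trans (restrict-pair Γ W i fr γ (χ ∘H Eⱼ.weaken) _) (·-∘ Γ γ χ Eⱼ.weaken)

        a-generic : elA ((γ ∙ weaken) ∙ generic)
        a-generic = subst elA (sym base) (rA a Eⱼ.weaken)

        a-generic≅ : a-generic ≅ rA a Eⱼ.weaken
        a-generic≅ = H.≡-subst-removable elA (sym base) _

        base▹ : _≡_ {A = ob (Γ ▹ A) (ext V j frj)}
                  ((γ ∙ weaken) ∙ generic , a-generic) (_·_ (Γ ▹ A) (γ ∙ χ , a) Eⱼ.weaken)
        base▹ = ,-≡ base a-generic≅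

        -- the value of f at the generic map lies over a base degenerate in j
        degenerate : Σ[ b ∈ elB (γ ∙ χ , a) ]
                       subst elB base▹ (app f generic a-generic) ≡ rst (str B) b Eⱼ.weaken
        degenerate = DB V j frj (γ ∙ χ , a) _

      b₀ : elB (γ ∙ χ , a)
      b₀ = proj₁ degenerate

      private
        generic-degenerate : app f generic a-generic ≅ rst (str B) b₀ Eⱼ.weaken
        generic-degenerate =
          H.trans (H.sym (H.≡-subst-removable elB base▹ _)) (H.≡-to-≅ (proj₂ degenerate))

      -- f(pair χ y , a) is the restriction of f(generic , a) along face_j y
      app-pair : ∀ y (a' : elA ((γ ∙ weaken) ∙ pair χ y)) → a' ≅ a → app f (pair χ y) a' ≅ b₀
      app-pair y a' a'≅a = begin
        app f (pair χ y) a'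
          ≅⟨ app-cong f (sym (generic-face y)) (H.trans a'≅a (H.sym a-face≅a)) ⟩
        app f (generic ∘H Eⱼ.face y) a-face
          ≅⟨ app-nat f generic a-generic (Eⱼ.face y) ⟨
        rst (str B) (app f generic a-generic) (Eⱼ.face y)
          ≅⟨ rst-cong (str B) base▹ generic-degenerate (Eⱼ.face y) ⟩
        rst (str B) (rst (str B) b₀ Eⱼ.weaken) (Eⱼ.face y)
          ≅⟨ rst-weaken-face B V j frj y b₀ ⟩
        b₀ ∎
        where
        open H.≅-Reasoning
        a-face : elA ((γ ∙ weaken) ∙ (generic ∘H Eⱼ.face y))
        a-face = castA A B (γ ∙ weaken) generic (Eⱼ.face y) (rA a-generic (Eⱼ.face y))
        a-face≅a : a-face ≅ a
        a-face≅a = H.trans (H.≡-subst-removable elA _ _)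
                   (H.trans (rst-cong (str A) base a-generic≅ (Eⱼ.face y))
                            (rst-weaken-face A V j frj y a))

    open Constant using (b₀; app-pair)

    app-independent : ∀ {V} (φ : Hom V (ext W i fr)) (a : elA ((γ ∙ weaken) ∙ φ)) y
                      (a' : elA ((γ ∙ weaken) ∙ pair (weaken ∘H φ) y)) → a' ≅ a →
                      app f (pair (weaken ∘H φ) y) a' ≅ app f φ a
    app-independent φ a y a' a'≅a = begin
      app f (pair χ y) a'  ≅⟨ app-pair χ a₀ y a' (H.trans a'≅a a≅a₀) ⟩
      b₀ χ a₀              ≅⟨ app-pair χ a₀ φi aη (H.trans aη≅a a≅a₀) ⟨
      app f (pair χ φi) aη ≅⟨ app-cong f (sym (pair-η φ)) aη≅a ⟩
      app f φ a            ∎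
      where
      open H.≅-Reasoning
      χ : Hom _ W
      χ = weaken ∘H φ
      φi : PVal _ _
      φi = lookup (pmap φ) (pos i (pth W))
      a₀ : elA (γ ∙ χ)
      a₀ = subst elA (sym (·-∘ Γ γ weaken φ)) a
      a≅a₀ : a ≅ a₀
      a≅a₀ = H.sym (H.≡-subst-removable elA _ a)
      aη : elA ((γ ∙ weaken) ∙ pair χ φi)
      aη = subst (λ ψ → elA ((γ ∙ weaken) ∙ ψ)) (pair-η φ) a
      aη≅a : aη ≅ a
      aη≅a = H.≡-subst-removable (λ ψ → elA ((γ ∙ weaken) ∙ ψ)) (pair-η φ) a

    f₀ : ΠEl A B γ
    f₀ = subst (ΠEl A B) (restrict-face Γ W i fr γ (pcst false)) (Πrst A B f (face (pcst false)))

    app-f₀ : ∀ {V} (χ : Hom V W) (a : elA (γ ∙ χ)) (a' : elA ((γ ∙ weaken) ∙ pair χ (pcst false))) →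
             a' ≅ a → app f₀ χ a ≅ app f (pair χ (pcst false)) a'
    app-f₀ χ a a' a'≅a = begin
      app f₀ χ a
        ≅⟨ app-subst (restrict-face Γ W i fr γ (pcst false)) (Πrst A B f face₀) χ a≅a₁ ⟩
      app (Πrst A B f face₀) χ a₁
        ≅⟨ app-Πrst f face₀ χ a₁ ⟩
      app f (face₀ ∘H χ) (castA A B (γ ∙ weaken) face₀ χ a₁)
        ≅⟨ app-cong f (face-∘ (pcst false) χ)
             (H.trans (castA-removable (γ ∙ weaken) face₀ χ a₁) (H.trans (H.sym a≅a₁) (H.sym a'≅a))) ⟩
      app f (pair χ (pcst false)) a' ∎
      where
      open H.≅-Reasoning
      face₀ : Hom W (ext W i fr)
      face₀ = face (pcst false)
      a₁ : elA (((γ ∙ weaken) ∙ face₀) ∙ χ)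
      a₁ = subst (λ δ → elA (δ ∙ χ)) (sym (restrict-face Γ W i fr γ (pcst false))) a
      a≅a₁ : a ≅ a₁
      a≅a₁ = H.sym (H.≡-subst-removable (λ δ → elA (δ ∙ χ)) _ a)

    app-weakening : ∀ {V} (φ : Hom V (ext W i fr)) (a : elA ((γ ∙ weaken) ∙ φ)) →
                    app (Πrst A B f₀ weaken) φ a ≅ app f φ a
    app-weakening φ a = begin
      app (Πrst A B f₀ weaken) φ a                 ≅⟨ app-Πrst f₀ weaken φ a ⟩
      app f₀ (weaken ∘H φ) a₁                     ≅⟨ app-f₀ (weaken ∘H φ) a₁ a₂ a₂≅a₁ ⟩
      app f (pair (weaken ∘H φ) (pcst false)) a₂   ≅⟨ app-independent φ a (pcst false) a₂ a₂≅a ⟩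
      app f φ a                                   ∎
      where
      open H.≅-Reasoning
      a₁ : elA (γ ∙ (weaken ∘H φ))
      a₁ = castA A B γ weaken φ a
      a₂ : elA ((γ ∙ weaken) ∙ pair (weaken ∘H φ) (pcst false))
      a₂ = subst elA (sym (restrict-pair Γ W i fr γ (weaken ∘H φ) (pcst false))) a₁
      a₂≅a₁ : a₂ ≅ a₁
      a₂≅a₁ = H.≡-subst-removable elA (sym (restrict-pair Γ W i fr γ (weaken ∘H φ) (pcst false))) a₁
      a₂≅a : a₂ ≅ a
      a₂≅a = H.trans a₂≅a₁ (castA-removable γ weaken φ a)

    weakening : f ≡ Πrst A B f₀ weaken
    weakening = ΠEl-ext f (Πrst A B f₀ weaken) λ φ a → H.≅-to-≡ (H.sym (app-weakening φ a))

  discreteOver-Π : DiscreteOver (str B) → DiscreteOver (ΠStr A B)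
  discreteOver-Π DB W i fr γ f = Weakened.f₀ DB W i fr γ f , Weakened.weakening DB W i fr γ f

mainTheorem6 :
    (∀ {Δ Γ : Ctx} (σ : Sub Δ Γ) (T : Ty Γ) →
       Discrete (str T) → Discrete (T [ σ ]))
    × (Extensionality 0ℓ 0ℓ → ∀ {Γ : Ctx} (A : Ty Γ) (B : Ty (Γ ▹ A)) →
       Discrete (str A) → Discrete (str B) → Discrete (ΠStr A B))
    × (∀ {Γ : Ctx} (A : Ty Γ) (B : Ty (Γ ▹ A)) →
       Discrete (str A) → Discrete (str B) → Discrete (ΣStr A B))
    × (∀ {Γ : Ctx} (A : Ty Γ) (a b : Tm Γ A) →
       Discrete (str A) → Discrete (IdStr A a b))
mainTheorem6 =
    (λ σ T D → over⇒discrete (T [ σ ])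
                 (discreteOver-substitution σ T (discrete⇒over (str T) D)))
  , (λ fe A B _ DB → over⇒discrete (ΠStr A B)
                       (PiDiscrete.discreteOver-Π fe A B (discrete⇒over (str B) DB)))
  , (λ A B DA DB → over⇒discrete (ΣStr A B)
                     (discreteOver-Σ A B (discrete⇒over (str A) DA) (discrete⇒over (str B) DB)))
  , (λ A a b _ → over⇒discrete (IdStr A a b) (discreteOver-Id A a b))
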